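{- Let $1\le\mathbf{a}<\mathbf{b}$ be co-prime integers, $k$ a positive integer, $a_1,\dots,a_s$ positive integers, and $S$ the sumset semigroup generated by $\{a_1\},\dots,\{a_s\},\{0,k\mathbf{a}\},\{0,k\mathbf{b}\}$, with ideal $I_S\subset\mathbf{k}[x_1,\dots,x_s,x,y]$ where $x_i$ corresponds to $\{a_i\}$, $x$ to $\{0,k\mathbf{a}\}$ and $y$ to $\{0,k\mathbf{b}\}$. Then $$I_S=I_{\langle a_1,\ldots,a_s\rangle}+\big\langle x^{\mathbf{b}-1}y^{\mathbf{a}-1}(x^{\mathbf{b}}-y^{\mathbf{a}})\big\rangle\subset\mathbf{k}[x_1,\dots,x_s,x,y],$$ where $I_{\langle a_1,\ldots,a_s\rangle}\subset\mathbf{k}[x_1,\dots,x_s]$ is the ideal of the sumset semigroup generated by $\{a_1\},\dots,\{a_s\}$ (equivalently the ideal generated by all $x^{\alpha}-x^{\beta}$ with $\sum\alpha_ia_i=\sum\beta_ia_i$), extended to the larger ring.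
   Context: $\mathrm{FS}(\mathbb{N})$ is the monoid of finite non-empty subsets of $\mathbb{N}$ under $A+B=\{a+b\mid a\in A,b\in B\}$; $\alpha\otimes A$ is the $\alpha$-fold sum of $A$ ($0\otimes A=\{0\}$). For a field $\mathbf{k}$ and generators $A_1,\dots,A_t$ of a submonoid $S$ of $\mathrm{FS}(\mathbb{N})$, its ideal $I_S\subset\mathbf{k}[x_1,\dots,x_t]$ is generated by all $x_1^{\alpha_1}\cdots x_t^{\alpha_t}-x_1^{\beta_1}\cdots x_t^{\beta_t}$ with $\sum_i\alpha_i\otimes A_i=\sum_i\beta_i\otimes A_i$. -}

module Defs where

open import Level using (Level; _⊔_)
open import Algebra.Bundles using (CommutativeRing)
open import Data.Nat using (ℕ; zero; suc)
import Data.Nat as ℕ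
open import Data.Nat.Properties using (_≟_)
import Data.Vec
open import Data.Vec using (Vec; []; _∷_; _++_; replicate)
open import Data.Vec.Properties using (≡-dec)
open import Data.List using (List; []; _∷_; map; concat; foldr)
open import Data.List.Membership.Propositional using (_∈_)
open import Data.List.Relation.Unary.All using (All)
open import Data.Sum using (_⊎_)
open import Data.Product using (Σ; ∃; ∃-syntax; _×_; _,_)
open import Relation.Binary.PropositionalEquality using (_≡_)
open import Relation.Nullary using (¬_; yes; no)
open import Function.Bundles using (_⇔_)

record Field (c ℓ : Level) : Set (Level.suc (c ⊔ ℓ)) where
  field
    commutativeRing : CommutativeRing c ℓ
  open CommutativeRing commutativeRing public
  field
    0≉1     : ¬ (0# ≈ 1#)
    inverse : ∀ x → ¬ (x ≈ 0#) → ∃[ y ] (x * y ≈ 1#)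

-- Finite sumsets in FS(ℕ).  A finite non-empty subset of ℕ is given by a
-- list of its elements (non-emptiness is checked where needed).
-- In⊗ n α A   means  n ∈ α ⊗ A  (with 0 ⊗ A = {0}).

In⊗ : ℕ → ℕ → List ℕ → Set
In⊗ n zero    A = n ≡ 0
In⊗ n (suc α) A = ∃[ a ] ∃[ m ] (a ∈ A × In⊗ m α A × n ≡ a ℕ.+ m)

InΣ⊗ : ∀ {t} → ℕ → Vec ℕ t → Vec (List ℕ) t → Set
InΣ⊗ n []       []       = n ≡ 0
InΣ⊗ n (α ∷ αs) (A ∷ As) = ∃[ m ] ∃[ r ] (In⊗ m α A × InΣ⊗ r αs As × n ≡ m ℕ.+ r)

SumsetEq : ∀ {t} → Vec (List ℕ) t → Vec ℕ t → Vec ℕ t → Set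
SumsetEq As α β = ∀ n → InΣ⊗ n α As ⇔ InΣ⊗ n β As

-- Polynomials in t variables over a field, as formal finite sums of terms
-- c · x^e (e an exponent vector), with the usual equality: equal
-- coefficients at every monomial.

module Poly {c ℓ} (F : Field c ℓ) where
  open Field F

  Monomial : ℕ → Set
  Monomial t = Vec ℕ t

  Pol : ℕ → Set c
  Pol t = List (Carrier × Monomial t)

  coeff : ∀ {t} → Pol t → Monomial t → Carrier
  coeff []             e = 0#
  coeff ((a , f) ∷ p) e with ≡-dec _≟_ f e
  ... | yes _ = a + coeff p e
  ... | no  _ = coeff p e

  _≈ₚ_ : ∀ {t} → Pol t → Pol t → Set ℓ
  p ≈ₚ q = ∀ e → coeff p e ≈ coeff q e

  _·ₘ_ : ∀ {t} → Monomial t → Monomial t → Monomial t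
  []       ·ₘ []       = []
  (a ∷ as) ·ₘ (b ∷ bs) = (a ℕ.+ b) ∷ (as ·ₘ bs)

  term* : ∀ {t} → Carrier → Monomial t → Pol t → Pol t
  term* a e p = map (λ { (b , f) → (a * b , e ·ₘ f) }) p

  binomial : ∀ {t} → Monomial t → Monomial t → Pol t
  binomial α β = (1# , α) ∷ (- 1# , β) ∷ []

  mono : ∀ {t} → Monomial t → Pol t
  mono e = (1# , e) ∷ []

  _*ₚ_ : ∀ {t} → Pol t → Pol t → Pol t
  p *ₚ q = concat (map (λ { (a , e) → term* a e q }) p)

  -- f ∈ ⟨ G ⟩ : f is a finite combination  Σ cⱼ x^{eⱼ} gⱼ  with gⱼ ∈ G
  -- (sums of term multiples suffice, as every polynomial is a sum of terms)
  Combination : ℕ → Set c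
  Combination t = List (Carrier × Monomial t × Pol t)

  evalComb : ∀ {t} → Combination t → Pol t
  evalComb L = concat (map (λ { (a , e , h) → term* a e h }) L)

  _∈Ideal_ : ∀ {t} {g} → Pol t → (Pol t → Set g) → Set (c ⊔ ℓ ⊔ g)
  _∈Ideal_ {t} f G =
    Σ (Combination t) λ L → All (λ { (_ , _ , h) → G h }) L × f ≈ₚ evalComb L

  BinomialGen : ∀ {t} → Vec (List ℕ) t → Pol t → Set ℓ
  BinomialGen {t} As p =
    ∃[ α ] ∃[ β ] (SumsetEq As α β × p ≈ₚ binomial {t} α β)

  module Cor10 (s : ℕ) (as : Vec ℕ s) (k 𝐚 𝐛 : ℕ) where
    gensS : Vec (List ℕ) (s ℕ.+ 2)
    gensS = Data.Vec.map (λ a → a ∷ []) as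
            ++ ((0 ∷ k ℕ.* 𝐚 ∷ []) ∷ (0 ∷ k ℕ.* 𝐛 ∷ []) ∷ [])

    gensA : Vec (List ℕ) s
    gensA = Data.Vec.map (λ a → a ∷ []) as

    I_S : Pol (s ℕ.+ 2) → Set (c ⊔ ℓ)
    I_S f = f ∈Ideal BinomialGen gensS

    ext : Vec ℕ s → ℕ → ℕ → Monomial (s ℕ.+ 2)
    ext α i j = α ++ (i ∷ j ∷ [])

    JGen : Pol (s ℕ.+ 2) → Set ℓ
    JGen p =
      (∃[ α ] ∃[ β ] (SumsetEq gensA α β ×
                      p ≈ₚ binomial (ext α 0 0) (ext β 0 0)))
      ⊎ (p ≈ₚ (mono (ext (replicate s 0) (𝐛 ℕ.∸ 1) (𝐚 ℕ.∸ 1))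
               *ₚ binomial (ext (replicate s 0) 𝐛 0) (ext (replicate s 0) 0 𝐚)))

    J : Pol (s ℕ.+ 2) → Set (c ⊔ ℓ)
    J f = f ∈Ideal JGen

{-# OPTIONS --safe #-}
module Submission where

-- Both ideals are generated by binomials, so it suffices to put the generators of each into
-- the other.  The sumset Σ αᵢ ⊗ {aᵢ} + i ⊗ {0, k𝐚} + j ⊗ {0, k𝐛} is the translate by Σ αᵢ aᵢ
-- of k times the box {p 𝐚 + q 𝐛 | p ≤ i, q ≤ j}, and two such sumsets agree iff the
-- translations and the boxes agree.  As 𝐚 and 𝐛 are coprime, the boxes of (i, j) and
-- (i′, j′) agree only if, up to symmetry, (i′, j′) = (i + t 𝐛, j − t 𝐚) with i ≥ 𝐛 − 1 and
-- j − t 𝐚 ≥ 𝐚 − 1.  Each of the t single trades is a monomial multiple of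
-- x^(𝐛−1) y^(𝐚−1) (x^𝐛 − y^𝐚), and they telescope to x^i y^j − x^i′ y^j′.

open import Defs
open import Level using (Level)
open import Data.Nat using (ℕ; _≤_; _<_; NonZero; >-nonZero)
open import Data.Nat.Properties using (<-trans)
open import Data.Nat.Coprimality using (Coprime)
open import Data.Vec using (Vec)
open import Data.Vec.Relation.Unary.All using (All)
open import Function.Bundles using (_⇔_)

module TwoGeneratorBoxes where
  open import Data.Nat
  open import Data.Nat.Properties
  open import Data.Nat.Divisibility using (_∣_; divides; ∣⇒≤; ∣m+n∣m⇒∣n)
  open import Data.Nat.Coprimality using (Coprime; coprime-divisor)
  import Data.Nat.Coprimality as Coprime
  open import Data.Nat.Tactic.RingSolver using (solve)
  open import Data.List using ([]; _∷_)
  open import Data.Product using (∃-syntax; _×_; _,_)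
  open import Data.Sum using (_⊎_; inj₁; inj₂)
  open import Relation.Nullary using (yes; no)
  open import Relation.Binary using (tri<; tri≈; tri>)
  open import Relation.Binary.PropositionalEquality
  open import Function.Base using (_∘_)
  open import Function.Bundles using (_⇔_; mk⇔; Equivalence)
  open Equivalence using (to; from)
  open ≡-Reasoning

  InBox : ℕ → ℕ → ℕ → ℕ → ℕ → Set
  InBox a b i j n = ∃[ p ] ∃[ q ] (p ≤ i × q ≤ j × n ≡ p * a + q * b)

  SameBox : ℕ → ℕ → ℕ → ℕ → ℕ → ℕ → Set
  SameBox a b i j i′ j′ = ∀ n → InBox a b i j n ⇔ InBox a b i′ j′ n

  Exchange : ℕ → ℕ → ℕ → ℕ → ℕ → ℕ → Set
  Exchange a b i j i′ j′ =
    ∃[ t ] (i′ ≡ i + t * b × j ≡ j′ + t * a × b ≤ suc i × a ≤ suc j′)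

  inBox-corner : ∀ a b i j → InBox a b i j (i * a + j * b)
  inBox-corner a b i j = i , j , ≤-refl , ≤-refl , refl

  inBox⇒≤corner : ∀ {a b i j n} → InBox a b i j n → n ≤ i * a + j * b
  inBox⇒≤corner {a} {b} (p , q , p≤i , q≤j , refl) =
    +-mono-≤ (*-monoˡ-≤ a p≤i) (*-monoˡ-≤ b q≤j)

  inBox-swap : ∀ {a b i j n} → InBox a b i j n → InBox b a j i n
  inBox-swap {a} {b} (p , q , p≤i , q≤j , n≡) =
    q , p , q≤j , p≤i , trans n≡ (+-comm (p * a) (q * b))

  inBox-scale : ∀ {a b i j n} k → InBox a b i j n → InBox (k * a) (k * b) i j (k * n)
  inBox-scale {a} {b} k (p , q , p≤i , q≤j , refl) =
    p , q , p≤i , q≤j , solve (k ∷ p ∷ a ∷ q ∷ b ∷ [])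

  inBox-unscale : ∀ {a b i j n} k .{{_ : NonZero k}} →
    InBox (k * a) (k * b) i j (k * n) → InBox a b i j n
  inBox-unscale {a} {b} {n = n} k (p , q , p≤i , q≤j , kn≡) =
    p , q , p≤i , q≤j ,
    *-cancelˡ-≡ n (p * a + q * b) k (trans kn≡ (solve (k ∷ p ∷ a ∷ q ∷ b ∷ [])))

  sameBox-sym : ∀ {a b i j i′ j′} → SameBox a b i j i′ j′ → SameBox a b i′ j′ i j
  sameBox-sym E n = mk⇔ (from (E n)) (to (E n))

  sameBox-unscale : ∀ {a b i j i′ j′} k .{{_ : NonZero k}} →
    SameBox (k * a) (k * b) i j i′ j′ → SameBox a b i j i′ j′
  sameBox-unscale k E n = mk⇔
    (inBox-unscale k ∘ to (E (k * n)) ∘ inBox-scale k)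
    (inBox-unscale k ∘ from (E (k * n)) ∘ inBox-scale k)

  sameBox⇒sameCorner : ∀ {a b i j i′ j′} → SameBox a b i j i′ j′ →
    i * a + j * b ≡ i′ * a + j′ * b
  sameBox⇒sameCorner {a} {b} {i} {j} {i′} {j′} E = ≤-antisym
    (inBox⇒≤corner (to (E _) (inBox-corner a b i j)))
    (inBox⇒≤corner (from (E _) (inBox-corner a b i′ j′)))

  coprime-multiple⇒≤ : ∀ {a b w q} .{{_ : NonZero w}} → Coprime a b →
    w * a ≡ q * b → b ≤ w
  coprime-multiple⇒≤ {a} {b} {w} {q} a⊥b wa≡qb =
    ∣⇒≤ (coprime-divisor (Coprime.sym a⊥b) (divides q (trans (*-comm a w) wa≡qb)))

  coprime-balance : ∀ {a b j j′ d} .{{_ : NonZero b}} → Coprime a b →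
    j * b ≡ j′ * b + a * d → ∃[ t ] (d ≡ t * b × j ≡ j′ + t * a)
  coprime-balance {a} {b} {j} {j′} {d} a⊥b jb≡
    with divides t d≡tb ← coprime-divisor (Coprime.sym a⊥b)
                            (∣m+n∣m⇒∣n (divides j (sym jb≡)) (divides j′ refl))
    = t , d≡tb , *-cancelʳ-≡ j (j′ + t * a) b (begin
      j * b                ≡⟨ jb≡ ⟩
      j′ * b + a * d       ≡⟨ cong (λ x → j′ * b + a * x) d≡tb ⟩
      j′ * b + a * (t * b) ≡⟨ solve (j′ ∷ b ∷ a ∷ t ∷ []) ⟩
      (j′ + t * a) * b     ∎)

  sameWeight⇒shift : ∀ {a b i j i′ j′} .{{_ : NonZero b}} → Coprime a b →
    i * a + j * b ≡ i′ * a + j′ * b → i ≤ i′ →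
    ∃[ t ] (i′ ≡ i + t * b × j ≡ j′ + t * a)
  sameWeight⇒shift {a} {b} {i} {j} {i′} {j′} a⊥b eq i≤i′
    with d , refl ← m≤n⇒∃[o]m+o≡n i≤i′
    with t , d≡tb , j≡ ← coprime-balance a⊥b (+-cancelˡ-≡ (i * a) _ _ (begin
      i * a + j * b            ≡⟨ eq ⟩
      (i + d) * a + j′ * b     ≡⟨ solve (i ∷ d ∷ a ∷ j′ ∷ b ∷ []) ⟩
      i * a + (j′ * b + a * d) ∎))
    = t , cong (i +_) d≡tb , j≡

  sameWeight⇒antitone : ∀ {a b i j i′ j′} .{{_ : NonZero a}} →
    i * a + j * b ≡ i′ * a + j′ * b → i < i′ → j′ < j
  sameWeight⇒antitone {a} {b} eq i<i′ = ≰⇒> λ j≤j′ →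
    <-irrefl eq (+-mono-<-≤ (*-monoˡ-< a i<i′) (*-monoˡ-≤ b j≤j′))

  -- (i + 1) a lies in the wider box; the narrower one can only write it as p a + q b
  -- with p ≤ i, and then b divides i + 1 − p > 0.
  widerBox⇒room : ∀ {a b i j i′ j′} → Coprime a b →
    (∀ n → InBox a b i′ j′ n → InBox a b i j n) → i < i′ → b ≤ suc i
  widerBox⇒room {a} {b} {i} a⊥b narrower i<i′
    with p , q , p≤i , _ , eq ← narrower (suc i * a) (suc i , 0 , i<i′ , z≤n , sym (+-identityʳ _))
    with w , refl ← m≤n⇒∃[o]m+o≡n p≤i
    = ≤-trans (coprime-multiple⇒≤ {q = q} a⊥b (+-cancelˡ-≡ (p * a) _ _ (begin
        p * a + suc w * a   ≡⟨ solve (p ∷ a ∷ w ∷ []) ⟩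
        suc (p + w) * a     ≡⟨ eq ⟩
        p * a + q * b       ∎)))
      (s≤s (m≤n+m w p))

  sameBox⇒exchange : ∀ {a b i j i′ j′} .{{_ : NonZero a}} .{{_ : NonZero b}} →
    Coprime a b → SameBox a b i j i′ j′ → i < i′ → Exchange a b i j i′ j′
  sameBox⇒exchange a⊥b E i<i′
    with t , i′≡ , j≡ ← sameWeight⇒shift a⊥b (sameBox⇒sameCorner E) (<⇒≤ i<i′)
    = t , i′≡ , j≡
    , widerBox⇒room a⊥b (λ n → from (E n)) i<i′
    , widerBox⇒room (Coprime.sym a⊥b) (λ n → inBox-swap ∘ to (E n) ∘ inBox-swap)
        (sameWeight⇒antitone (sameBox⇒sameCorner E) i<i′)

  sameBox-classify : ∀ {a b i j i′ j′} .{{_ : NonZero a}} .{{_ : NonZero b}} →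
    Coprime a b → SameBox a b i j i′ j′ →
    (i ≡ i′ × j ≡ j′) ⊎ Exchange a b i j i′ j′ ⊎ Exchange a b i′ j′ i j
  sameBox-classify {a} {b} {i} {j} {i′} {j′} a⊥b E with <-cmp i i′
  ... | tri< i<i′ _ _ = inj₂ (inj₁ (sameBox⇒exchange a⊥b E i<i′))
  ... | tri> _ _ i′<i = inj₂ (inj₂ (sameBox⇒exchange a⊥b (sameBox-sym E) i′<i))
  ... | tri≈ _ refl _ =
    inj₁ (refl , *-cancelʳ-≡ j j′ b (+-cancelˡ-≡ (i * a) _ _ (sameBox⇒sameCorner E)))

  inBox-trade : ∀ {A B a b i j n} → b * A ≡ a * B → b ≤ suc i →
    InBox A B (i + b) j n → InBox A B i (j + a) n
  inBox-trade {A} {B} {a} {b} {i} {j} bA≡aB b≤1+i (p , q , p≤i+b , q≤j , refl)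
    with p ≤? i
  ... | yes p≤i = p , q , p≤i , m≤n⇒m≤n+o a q≤j , refl
  ... | no p≰i with p′ , refl ← m≤n⇒∃[o]m+o≡n (≤-trans b≤1+i (≰⇒> p≰i)) =
    p′ , q + a , +-cancelˡ-≤ b p′ i (subst (b + p′ ≤_) (+-comm i b) p≤i+b)
    , +-monoˡ-≤ a q≤j , (begin
      (b + p′) * A + q * B     ≡⟨ solve (b ∷ p′ ∷ A ∷ q ∷ B ∷ []) ⟩
      b * A + (p′ * A + q * B) ≡⟨ cong (_+ (p′ * A + q * B)) bA≡aB ⟩
      a * B + (p′ * A + q * B) ≡⟨ solve (a ∷ B ∷ p′ ∷ A ∷ q ∷ []) ⟩
      p′ * A + (q + a) * B     ∎)

  trade⇒sameBox : ∀ {A B a b i j} → b * A ≡ a * B → b ≤ suc i → a ≤ suc j →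
    SameBox A B (i + b) j i (j + a)
  trade⇒sameBox bA≡aB b≤1+i a≤1+j n = mk⇔
    (inBox-trade bA≡aB b≤1+i)
    (inBox-swap ∘ inBox-trade (sym bA≡aB) a≤1+j ∘ inBox-swap)

module Sumsets where
  open import Data.Nat
  open import Data.Nat.Properties
  open import Data.List using (List; []; _∷_; [_])
  open import Data.List.Relation.Unary.Any using (here; there)
  open import Data.Vec using (Vec; []; _∷_; _++_; map; zipWith; sum)
  open import Data.Product using (∃-syntax; _×_; _,_)
  open import Relation.Binary.PropositionalEquality
    using (_≡_; refl; sym; trans; cong; cong₂; subst)
  open import Function.Base using (_∘_)
  open import Function.Bundles using (_⇔_; mk⇔; Equivalence)
  open Equivalence using (to; from)
  open TwoGeneratorBoxes

  _·_ : ∀ {s} → Vec ℕ s → Vec ℕ s → ℕ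
  α · as = sum (zipWith _*_ α as)

  singletons : ∀ {s} → Vec ℕ s → Vec (List ℕ) s
  singletons = map [_]

  singletonsAndPairs : ∀ {s} → Vec ℕ s → ℕ → ℕ → Vec (List ℕ) (s + 2)
  singletonsAndPairs as A B = singletons as ++ (0 ∷ A ∷ []) ∷ (0 ∷ B ∷ []) ∷ []

  In⊗-singleton : ∀ {a m} α → In⊗ m α [ a ] ⇔ m ≡ α * a
  In⊗-singleton α = mk⇔ (to′ α) (from′ α)
    where
    to′ : ∀ {a m} α → In⊗ m α [ a ] → m ≡ α * a
    to′ zero    m≡0                             = m≡0
    to′ (suc α) (_ , m′ , here refl , m′∈ , refl) = cong (_ +_) (to′ α m′∈)
    from′ : ∀ {a m} α → m ≡ α * a → In⊗ m α [ a ]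
    from′ zero    m≡0  = m≡0
    from′ (suc α) refl = _ , _ , here refl , from′ α refl , refl

  In⊗-pair : ∀ {D m} i → In⊗ m i (0 ∷ D ∷ []) ⇔ (∃[ p ] (p ≤ i × m ≡ p * D))
  In⊗-pair i = mk⇔ (to′ i) (from′ i)
    where
    to′ : ∀ {D m} i → In⊗ m i (0 ∷ D ∷ []) → ∃[ p ] (p ≤ i × m ≡ p * D)
    to′ zero m≡0 = 0 , z≤n , m≡0
    to′ (suc i) (_ , m′ , here refl , m′∈ , refl) with p , p≤i , refl ← to′ i m′∈ =
      p , m≤n⇒m≤1+n p≤i , refl
    to′ (suc i) (_ , m′ , there (here refl) , m′∈ , refl) with p , p≤i , refl ← to′ i m′∈ =
      suc p , s≤s p≤i , refl
    from′ : ∀ {D m} i → ∃[ p ] (p ≤ i × m ≡ p * D) → In⊗ m i (0 ∷ D ∷ [])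
    from′ zero    (_ , z≤n , m≡0) = m≡0
    from′ (suc i) (zero  , _ , refl) = 0 , 0 , here refl , from′ i (0 , z≤n , refl) , refl
    from′ (suc i) (suc p , s≤s p≤i , refl) =
      _ , _ , there (here refl) , from′ i (p , p≤i , refl) , refl

  InΣ⊗-singletons : ∀ {s n} (as α : Vec ℕ s) → InΣ⊗ n α (singletons as) ⇔ n ≡ α · as
  InΣ⊗-singletons as α = mk⇔ (to′ as α) (from′ as α)
    where
    to′ : ∀ {s n} (as α : Vec ℕ s) → InΣ⊗ n α (singletons as) → n ≡ α · as
    to′ []       []      n≡0 = n≡0
    to′ (a ∷ as) (x ∷ α) (m , r , m∈ , r∈ , refl) =
      cong₂ _+_ (to (In⊗-singleton x) m∈) (to′ as α r∈)
    from′ : ∀ {s n} (as α : Vec ℕ s) → n ≡ α · as → InΣ⊗ n α (singletons as)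
    from′ []       []      n≡0  = n≡0
    from′ (a ∷ as) (x ∷ α) refl =
      _ , _ , from (In⊗-singleton x) refl , from′ as α refl , refl

  InΣ⊗-singletonsAndPairs : ∀ {s n A B i j} (as α : Vec ℕ s) →
    InΣ⊗ n (α ++ i ∷ j ∷ []) (singletonsAndPairs as A B) ⇔
    (∃[ r ] (InBox A B i j r × n ≡ α · as + r))
  InΣ⊗-singletonsAndPairs as α = mk⇔ (to′ as α) (from′ as α)
    where
    to′ : ∀ {s n A B i j} (as α : Vec ℕ s) →
      InΣ⊗ n (α ++ i ∷ j ∷ []) (singletonsAndPairs as A B) →
      ∃[ r ] (InBox A B i j r × n ≡ α · as + r)
    to′ {A = A} {B} {i} {j} [] [] (_ , _ , m∈ , (_ , _ , m′∈ , refl , refl) , refl)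
      with p , p≤i , refl ← to (In⊗-pair i) m∈
      with q , q≤j , refl ← to (In⊗-pair j) m′∈
      = _ , (p , q , p≤i , q≤j , cong (p * A +_) (+-identityʳ (q * B))) , refl
    to′ (a ∷ as) (x ∷ α) (m , _ , m∈ , r∈ , refl)
      with r , r∈box , refl ← to′ as α r∈
      rewrite to (In⊗-singleton x) m∈
      = r , r∈box , sym (+-assoc (x * a) (α · as) r)
    from′ : ∀ {s n A B i j} (as α : Vec ℕ s) →
      ∃[ r ] (InBox A B i j r × n ≡ α · as + r) →
      InΣ⊗ n (α ++ i ∷ j ∷ []) (singletonsAndPairs as A B)
    from′ {A = A} {B} {i} {j} [] [] (_ , (p , q , p≤i , q≤j , refl) , refl) =
      _ , _ , from (In⊗-pair i) (p , p≤i , refl)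
      , (_ , 0 , from (In⊗-pair j) (q , q≤j , refl) , refl , refl)
      , cong (p * A +_) (sym (+-identityʳ (q * B)))
    from′ (a ∷ as) (x ∷ α) (r , r∈box , refl) =
      _ , _ , from (In⊗-singleton x) refl , from′ as α (r , r∈box , refl)
      , +-assoc (x * a) (α · as) r

  sumsetEq-singletons : ∀ {s} (as α β : Vec ℕ s) →
    SumsetEq (singletons as) α β ⇔ (α · as ≡ β · as)
  sumsetEq-singletons as α β = mk⇔
    (λ E → to (char β) (to (E _) (from (char α) refl)))
    (λ w≡ n → mk⇔ (from (char β) ∘ (λ n≡ → trans n≡ w≡) ∘ to (char α))
                  (from (char α) ∘ (λ n≡ → trans n≡ (sym w≡)) ∘ to (char β)))
    where
    char : ∀ γ {n} → InΣ⊗ n γ (singletons as) ⇔ n ≡ γ · as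
    char γ = InΣ⊗-singletons as γ

  module _ {s A B : ℕ} (as : Vec ℕ s) where

    private
      In : Vec ℕ s → ℕ → ℕ → ℕ → Set
      In α i j n = InΣ⊗ n (α ++ i ∷ j ∷ []) (singletonsAndPairs as A B)

      In-char : ∀ α {i j n} → In α i j n ⇔ (∃[ r ] (InBox A B i j r × n ≡ α · as + r))
      In-char α = InΣ⊗-singletonsAndPairs as α

      ⊆⇒weight≥ : ∀ {α β i j i′ j′} → (∀ n → In α i j n → In β i′ j′ n) → β · as ≤ α · as
      ⊆⇒weight≥ {α} {β} α⊆β
        with r , _ , α·as≡ ← to (In-char β) (α⊆β _ (from (In-char α)
               (0 , (0 , 0 , z≤n , z≤n , refl) , sym (+-identityʳ _))))
        = subst (β · as ≤_) (sym α·as≡) (m≤m+n (β · as) r)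

      ⊆⇒box⊆ : ∀ {α β i j i′ j′} → α · as ≡ β · as → (∀ n → In α i j n → In β i′ j′ n) →
        ∀ r → InBox A B i j r → InBox A B i′ j′ r
      ⊆⇒box⊆ {α} {β} w≡ α⊆β r r∈box
        with r′ , r′∈box , eq ← to (In-char β) (α⊆β _ (from (In-char α) (r , r∈box , refl)))
        = subst (InBox A B _ _)
            (sym (+-cancelˡ-≡ (β · as) r r′ (trans (cong (_+ r) (sym w≡)) eq))) r′∈box

      box⊆⇒⊆ : ∀ {α β i j i′ j′} → α · as ≡ β · as →
        (∀ r → InBox A B i j r → InBox A B i′ j′ r) → ∀ n → In α i j n → In β i′ j′ n
      box⊆⇒⊆ {α} {β} w≡ box⊆ n n∈
        with r , r∈box , n≡ ← to (In-char α) n∈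
        = from (In-char β) (r , box⊆ r r∈box , trans n≡ (cong (_+ r) w≡))

    sumsetEq-singletonsAndPairs : ∀ {α β : Vec ℕ s} {i j i′ j′} →
      SumsetEq (singletonsAndPairs as A B) (α ++ i ∷ j ∷ []) (β ++ i′ ∷ j′ ∷ []) ⇔
      (α · as ≡ β · as × SameBox A B i j i′ j′)
    sumsetEq-singletonsAndPairs = mk⇔
      (λ E → let w≡ = ≤-antisym (⊆⇒weight≥ (from ∘ E)) (⊆⇒weight≥ (to ∘ E)) in
        w≡ , λ r → mk⇔ (⊆⇒box⊆ w≡ (to ∘ E) r) (⊆⇒box⊆ (sym w≡) (from ∘ E) r))
      (λ (w≡ , E) n → mk⇔ (box⊆⇒⊆ w≡ (to ∘ E) n) (box⊆⇒⊆ (sym w≡) (from ∘ E) n))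

module BinomialIdeals {c ℓ} (F : Field c ℓ) where
  open Field F
  open Poly F
  open import Algebra.Properties.Ring ring using (-1*x≈-x; ⁻¹-anti-homo‿-)
  open import Relation.Binary.Reasoning.Setoid setoid
  import Data.Nat as ℕ
  import Data.Nat.Properties as ℕₚ
  open import Data.Vec using ([]; _∷_; replicate; head; tail)
  import Data.Vec as Vec
  open import Data.Vec.Properties using (≡-dec)
  open import Data.List using ([]; _∷_; _++_; map; concat)
  open import Data.List.Properties using (map-++; concat-++)
  open import Data.List.Relation.Binary.Pointwise using (Pointwise; []; _∷_)
  open import Data.List.Relation.Unary.All using ([]; _∷_) renaming (All to AllL)
  open import Data.List.Relation.Unary.All.Properties using (++⁺; map⁺)
  open import Data.Product using (∃-syntax; _×_; _,_)
  open import Data.Sum using (_⊎_; inj₁; inj₂)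
  open import Relation.Nullary using (yes; no; contradiction)
  open import Relation.Binary.PropositionalEquality using (_≢_)
  import Relation.Binary.PropositionalEquality as ≡
  open ≡ using (_≡_)

  ε : ∀ {t} → Monomial t
  ε = replicate _ 0

  ·ₘ-identityˡ : ∀ {t} (e : Monomial t) → ε ·ₘ e ≡ e
  ·ₘ-identityˡ []      = ≡.refl
  ·ₘ-identityˡ (x ∷ e) = ≡.cong (x ∷_) (·ₘ-identityˡ e)

  ·ₘ-identityʳ : ∀ {t} (e : Monomial t) → e ·ₘ ε ≡ e
  ·ₘ-identityʳ []      = ≡.refl
  ·ₘ-identityʳ (x ∷ e) = ≡.cong₂ _∷_ (ℕₚ.+-identityʳ x) (·ₘ-identityʳ e)

  ·ₘ-assoc : ∀ {t} (e f g : Monomial t) → (e ·ₘ f) ·ₘ g ≡ e ·ₘ (f ·ₘ g)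
  ·ₘ-assoc []      []      []      = ≡.refl
  ·ₘ-assoc (x ∷ e) (y ∷ f) (z ∷ g) = ≡.cong₂ _∷_ (ℕₚ.+-assoc x y z) (·ₘ-assoc e f g)

  ·ₘ-cancelˡ : ∀ {t} (e f g : Monomial t) → e ·ₘ f ≡ e ·ₘ g → f ≡ g
  ·ₘ-cancelˡ []      []      []      _  = ≡.refl
  ·ₘ-cancelˡ (x ∷ e) (y ∷ f) (z ∷ g) eq =
    ≡.cong₂ _∷_ (ℕₚ.+-cancelˡ-≡ x y z (≡.cong head eq))
                (·ₘ-cancelˡ e f g (≡.cong tail eq))

  ·ₘ-comm : ∀ {t} (e f : Monomial t) → e ·ₘ f ≡ f ·ₘ e
  ·ₘ-comm []      []      = ≡.refl
  ·ₘ-comm (x ∷ e) (y ∷ f) = ≡.cong₂ _∷_ (ℕₚ.+-comm x y) (·ₘ-comm e f)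

  ++-·ₘ : ∀ {s t} (e f : Monomial s) (g h : Monomial t) →
    (e Vec.++ g) ·ₘ (f Vec.++ h) ≡ (e ·ₘ f) Vec.++ (g ·ₘ h)
  ++-·ₘ []      []      g h = ≡.refl
  ++-·ₘ (x ∷ e) (y ∷ f) g h = ≡.cong (x ℕ.+ y ∷_) (++-·ₘ e f g h)

  ∣ₘ? : ∀ {t} (e m : Monomial t) → (∃[ g ] e ·ₘ g ≡ m) ⊎ (∀ g → e ·ₘ g ≢ m)
  ∣ₘ? [] [] = inj₁ ([] , ≡.refl)
  ∣ₘ? (x ∷ e) (y ∷ m) with ∣ₘ? e m | x ℕₚ.≤? y
  ... | inj₂ e∤m          | _       = inj₂ λ { (_ ∷ g) eq → e∤m g (≡.cong tail eq) }
  ... | inj₁ (g , ≡.refl) | yes x≤y = inj₁ (y ℕ.∸ x ∷ g , ≡.cong (_∷ _) (ℕₚ.m+[n∸m]≡n x≤y))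
  ... | inj₁ _            | no x≰y  =
    inj₂ λ { (z ∷ _) eq → x≰y (≡.subst (x ℕ.≤_) (≡.cong head eq) (ℕₚ.m≤m+n x z)) }

  coeff-++ : ∀ {t} (p q : Pol t) e → coeff (p ++ q) e ≈ coeff p e + coeff q e
  coeff-++ []            q e = sym (+-identityˡ _)
  coeff-++ ((a , f) ∷ p) q e with ≡-dec ℕₚ._≟_ f e
  ... | yes _ = trans (+-congˡ (coeff-++ p q e)) (sym (+-assoc _ _ _))
  ... | no _  = coeff-++ p q e

  coeff-term*-·ₘ : ∀ {t} a (e : Monomial t) p g →
    coeff (term* a e p) (e ·ₘ g) ≈ a * coeff p g
  coeff-term*-·ₘ a e []            g = sym (zeroʳ a)
  coeff-term*-·ₘ a e ((b , f) ∷ p) g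
    with ≡-dec ℕₚ._≟_ (e ·ₘ f) (e ·ₘ g) | ≡-dec ℕₚ._≟_ f g
  ... | yes _   | yes _   = trans (+-congˡ (coeff-term*-·ₘ a e p g)) (sym (distribˡ a b _))
  ... | no _    | no _    = coeff-term*-·ₘ a e p g
  ... | yes ef≡eg | no f≢g  = contradiction (·ₘ-cancelˡ e f g ef≡eg) f≢g
  ... | no ef≢eg  | yes f≡g = contradiction (≡.cong (e ·ₘ_) f≡g) ef≢eg

  coeff-term*-∤ : ∀ {t} a (e : Monomial t) p {m} → (∀ g → e ·ₘ g ≢ m) →
    coeff (term* a e p) m ≈ 0#
  coeff-term*-∤ a e []            e∤m = refl
  coeff-term*-∤ a e ((b , f) ∷ p) {m} e∤m with ≡-dec ℕₚ._≟_ (e ·ₘ f) m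
  ... | yes ef≡m = contradiction ef≡m (e∤m f)
  ... | no _     = coeff-term*-∤ a e p e∤m

  coeff-term*-ε : ∀ {t} a p (e : Monomial t) → coeff (term* a ε p) e ≈ a * coeff p e
  coeff-term*-ε a p e =
    ≡.subst (λ m → coeff (term* a ε p) m ≈ a * coeff p e) (·ₘ-identityˡ e)
      (coeff-term*-·ₘ a ε p e)

  coeff-∷ : ∀ {t} a (f : Monomial t) p e →
    coeff ((a , f) ∷ p) e ≈ a * coeff (mono f) e + coeff p e
  coeff-∷ a f p e with ≡-dec ℕₚ._≟_ f e
  ... | yes _ = +-congʳ (sym (trans (*-congˡ (+-identityʳ 1#)) (*-identityʳ a)))
  ... | no _  = sym (trans (+-congʳ (zeroʳ a)) (+-identityˡ _))

  coeff-binomial : ∀ {t} (A B e : Monomial t) →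
    coeff (binomial A B) e ≈ coeff (mono A) e - coeff (mono B) e
  coeff-binomial A B e = begin
    coeff (binomial A B) e
      ≈⟨ coeff-∷ 1# A _ e ⟩
    1# * coeff (mono A) e + coeff ((- 1# , B) ∷ []) e
      ≈⟨ +-cong (*-identityˡ _) (coeff-∷ (- 1#) B [] e) ⟩
    coeff (mono A) e + (- 1# * coeff (mono B) e + 0#)
      ≈⟨ +-congˡ (trans (+-identityʳ _) (-1*x≈-x _)) ⟩
    coeff (mono A) e - coeff (mono B) e
      ∎

  _≈ᵗ_ : ∀ {t} → Carrier × Monomial t → Carrier × Monomial t → Set ℓ
  (a , f) ≈ᵗ (b , g) = a ≈ b × f ≡ g

  pointwise⇒≈ₚ : ∀ {t} {p q : Pol t} → Pointwise _≈ᵗ_ p q → p ≈ₚ q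
  pointwise⇒≈ₚ []                                        e = refl
  pointwise⇒≈ₚ {p = (a , f) ∷ p} {(b , _) ∷ q} ((a≈b , ≡.refl) ∷ p≈q) e = begin
    coeff ((a , f) ∷ p) e             ≈⟨ coeff-∷ a f p e ⟩
    a * coeff (mono f) e + coeff p e  ≈⟨ +-cong (*-congʳ a≈b) (pointwise⇒≈ₚ p≈q e) ⟩
    b * coeff (mono f) e + coeff q e  ≈⟨ coeff-∷ b f q e ⟨
    coeff ((b , f) ∷ q) e             ∎

  term*-cong : ∀ {t} a (e : Monomial t) {p q} → p ≈ₚ q → term* a e p ≈ₚ term* a e q
  term*-cong a e {p} {q} p≈q m with ∣ₘ? e m
  ... | inj₁ (g , ≡.refl) = begin
    coeff (term* a e p) (e ·ₘ g)  ≈⟨ coeff-term*-·ₘ a e p g ⟩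
    a * coeff p g                 ≈⟨ *-congˡ (p≈q g) ⟩
    a * coeff q g                 ≈⟨ coeff-term*-·ₘ a e q g ⟨
    coeff (term* a e q) (e ·ₘ g)  ∎
  ... | inj₂ e∤m = trans (coeff-term*-∤ a e p e∤m) (sym (coeff-term*-∤ a e q e∤m))

  term*-term* : ∀ {t} a b (e f : Monomial t) p →
    Pointwise _≈ᵗ_ (term* a e (term* b f p)) (term* (a * b) (e ·ₘ f) p)
  term*-term* a b e f []            = []
  term*-term* a b e f ((x , g) ∷ p) =
    (sym (*-assoc a b x) , ≡.sym (·ₘ-assoc e f g)) ∷ term*-term* a b e f p

  binomial-refl : ∀ {t} (A : Monomial t) → binomial A A ≈ₚ []
  binomial-refl A e = trans (coeff-binomial A A e) (-‿inverseʳ _)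

  binomial-sym : ∀ {t} (A B : Monomial t) → binomial B A ≈ₚ term* (- 1#) ε (binomial A B)
  binomial-sym A B e = begin
    coeff (binomial B A) e                      ≈⟨ coeff-binomial B A e ⟩
    coeff (mono B) e - coeff (mono A) e         ≈⟨ ⁻¹-anti-homo‿- _ _ ⟨
    - (coeff (mono A) e - coeff (mono B) e)     ≈⟨ -‿cong (coeff-binomial A B e) ⟨
    - coeff (binomial A B) e                    ≈⟨ -1*x≈-x _ ⟨
    - 1# * coeff (binomial A B) e               ≈⟨ coeff-term*-ε (- 1#) (binomial A B) e ⟨
    coeff (term* (- 1#) ε (binomial A B)) e     ∎

  binomial-trans : ∀ {t} (A B C : Monomial t) →
    binomial A C ≈ₚ (binomial A B ++ binomial B C)
  binomial-trans A B C e = begin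
    coeff (binomial A C) e                           ≈⟨ coeff-binomial A C e ⟩
    x - z                                            ≈⟨ +-congʳ (+-identityʳ x) ⟨
    (x + 0#) - z                                     ≈⟨ +-congʳ (+-congˡ (-‿inverseˡ y)) ⟨
    (x + (- y + y)) - z                              ≈⟨ +-congʳ (+-assoc x (- y) y) ⟨
    ((x - y) + y) - z                                ≈⟨ +-assoc (x - y) y (- z) ⟩
    (x - y) + (y - z)
      ≈⟨ +-cong (coeff-binomial A B e) (coeff-binomial B C e) ⟨
    coeff (binomial A B) e + coeff (binomial B C) e
      ≈⟨ coeff-++ (binomial A B) (binomial B C) e ⟨
    coeff (binomial A B ++ binomial B C) e           ∎
    where
    x y z : Carrier
    x = coeff (mono A) e
    y = coeff (mono B) e
    z = coeff (mono C) e

  binomial-·ₘ : ∀ {t} (e A B : Monomial t) →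
    binomial (e ·ₘ A) (e ·ₘ B) ≈ₚ term* 1# e (binomial A B)
  binomial-·ₘ e A B =
    pointwise⇒≈ₚ {p = binomial (e ·ₘ A) (e ·ₘ B)} {q = term* 1# e (binomial A B)}
      ((sym (*-identityˡ 1#) , ≡.refl) ∷ (sym (*-identityˡ (- 1#)) , ≡.refl) ∷ [])

  mono-*ₚ-binomial : ∀ {t} (e A B : Monomial t) →
    (mono e *ₚ binomial A B) ≈ₚ binomial (e ·ₘ A) (e ·ₘ B)
  mono-*ₚ-binomial e A B m = begin
    coeff (term* 1# e (binomial A B) ++ []) m  ≈⟨ coeff-++ (term* 1# e (binomial A B)) [] m ⟩
    coeff (term* 1# e (binomial A B)) m + 0#   ≈⟨ +-identityʳ _ ⟩
    coeff (term* 1# e (binomial A B)) m        ≈⟨ binomial-·ₘ e A B m ⟨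
    coeff (binomial (e ·ₘ A) (e ·ₘ B)) m       ∎

  evalComb-++ : ∀ {t} (K K′ : Combination t) →
    evalComb (K ++ K′) ≡ evalComb K ++ evalComb K′
  evalComb-++ K K′ =
    ≡.trans (≡.cong concat (map-++ _ K K′)) (≡.sym (concat-++ (map _ K) (map _ K′)))

  scaleComb : ∀ {t} → Carrier → Monomial t → Combination t → Combination t
  scaleComb a e = map λ (b , f , h) → (a * b , e ·ₘ f , h)

  term*-evalComb : ∀ {t} a (e : Monomial t) K →
    term* a e (evalComb K) ≈ₚ evalComb (scaleComb a e K)
  term*-evalComb a e []              m = refl
  term*-evalComb a e ((b , f , h) ∷ K) m = begin
    coeff (term* a e (term* b f h ++ evalComb K)) m
      ≡⟨ ≡.cong (λ p → coeff p m) (map-++ _ (term* b f h) (evalComb K)) ⟩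
    coeff (term* a e (term* b f h) ++ term* a e (evalComb K)) m
      ≈⟨ coeff-++ (term* a e (term* b f h)) _ m ⟩
    coeff (term* a e (term* b f h)) m + coeff (term* a e (evalComb K)) m
      ≈⟨ +-cong (pointwise⇒≈ₚ (term*-term* a b e f h) m) (term*-evalComb a e K m) ⟩
    coeff (term* (a * b) (e ·ₘ f) h) m + coeff (evalComb (scaleComb a e K)) m
      ≈⟨ coeff-++ (term* (a * b) (e ·ₘ f) h) _ m ⟨
    coeff (evalComb (scaleComb a e ((b , f , h) ∷ K))) m
      ∎

  module _ {t g} (G : Pol t → Set g) where

    ∈Ideal-resp : ∀ f f′ → f ≈ₚ f′ → f′ ∈Ideal G → f ∈Ideal G
    ∈Ideal-resp f f′ f≈f′ (K , K⊆G , f′≈K) = K , K⊆G , λ e → trans (f≈f′ e) (f′≈K e)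

    []∈Ideal : [] ∈Ideal G
    []∈Ideal = [] , [] , λ e → refl

    gen∈Ideal : ∀ h → G h → h ∈Ideal G
    gen∈Ideal h Gh = (1# , ε , h) ∷ [] , Gh ∷ [] , λ e → sym (begin
      coeff (term* 1# ε h ++ []) e     ≈⟨ coeff-++ (term* 1# ε h) [] e ⟩
      coeff (term* 1# ε h) e + 0#      ≈⟨ +-identityʳ _ ⟩
      coeff (term* 1# ε h) e           ≈⟨ coeff-term*-ε 1# h e ⟩
      1# * coeff h e                   ≈⟨ *-identityˡ _ ⟩
      coeff h e                        ∎)

    ++∈Ideal : ∀ f f′ → f ∈Ideal G → f′ ∈Ideal G → (f ++ f′) ∈Ideal G
    ++∈Ideal f f′ (K , K⊆G , f≈K) (K′ , K′⊆G , f′≈K′) =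
      K ++ K′ , ++⁺ K⊆G K′⊆G , λ e → begin
      coeff (f ++ f′) e
        ≈⟨ coeff-++ f f′ e ⟩
      coeff f e + coeff f′ e
        ≈⟨ +-cong (f≈K e) (f′≈K′ e) ⟩
      coeff (evalComb K) e + coeff (evalComb K′) e
        ≈⟨ coeff-++ (evalComb K) (evalComb K′) e ⟨
      coeff (evalComb K ++ evalComb K′) e
        ≡⟨ ≡.cong (λ p → coeff p e) (evalComb-++ K K′) ⟨
      coeff (evalComb (K ++ K′)) e
        ∎

    term*∈Ideal : ∀ a e f → f ∈Ideal G → term* a e f ∈Ideal G
    term*∈Ideal a e f (K , K⊆G , f≈K) =
      scaleComb a e K , map⁺ K⊆G ,
      λ m → trans (term*-cong a e {f} {evalComb K} f≈K m) (term*-evalComb a e K m)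

    binomial-refl∈Ideal : ∀ A → binomial A A ∈Ideal G
    binomial-refl∈Ideal A = ∈Ideal-resp (binomial A A) [] (binomial-refl A) []∈Ideal

    binomial-sym∈Ideal : ∀ A B → binomial A B ∈Ideal G → binomial B A ∈Ideal G
    binomial-sym∈Ideal A B AB =
      ∈Ideal-resp (binomial B A) (term* (- 1#) ε (binomial A B)) (binomial-sym A B)
        (term*∈Ideal (- 1#) ε (binomial A B) AB)

    binomial-trans∈Ideal : ∀ A B C →
      binomial A B ∈Ideal G → binomial B C ∈Ideal G → binomial A C ∈Ideal G
    binomial-trans∈Ideal A B C AB BC =
      ∈Ideal-resp (binomial A C) (binomial A B ++ binomial B C) (binomial-trans A B C)
        (++∈Ideal (binomial A B) (binomial B C) AB BC)

    binomial-·ₘ∈Ideal : ∀ e A B →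
      binomial A B ∈Ideal G → binomial (e ·ₘ A) (e ·ₘ B) ∈Ideal G
    binomial-·ₘ∈Ideal e A B AB =
      ∈Ideal-resp (binomial (e ·ₘ A) (e ·ₘ B)) (term* 1# e (binomial A B)) (binomial-·ₘ e A B)
        (term*∈Ideal 1# e (binomial A B) AB)

    binomial-·ₘ-cong∈Ideal : ∀ A B C D → binomial A B ∈Ideal G → binomial C D ∈Ideal G →
      binomial (A ·ₘ C) (B ·ₘ D) ∈Ideal G
    binomial-·ₘ-cong∈Ideal A B C D AB CD =
      binomial-trans∈Ideal (A ·ₘ C) (B ·ₘ C) (B ·ₘ D)
        (≡.subst₂ (λ X Y → binomial X Y ∈Ideal G) (·ₘ-comm C A) (·ₘ-comm C B)
          (binomial-·ₘ∈Ideal C A B AB))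
        (binomial-·ₘ∈Ideal B C D CD)

  ∈Ideal-trans : ∀ {t g g′} {G : Pol t → Set g} {H : Pol t → Set g′} →
    (∀ h → G h → h ∈Ideal H) → ∀ f → f ∈Ideal G → f ∈Ideal H
  ∈Ideal-trans {G = G} {H} G⊆⟨H⟩ f (K , K⊆G , f≈K) =
    ∈Ideal-resp H f (evalComb K) f≈K (evalComb∈Ideal K K⊆G)
    where
    evalComb∈Ideal : ∀ K → AllL (λ (_ , _ , h) → G h) K → evalComb K ∈Ideal H
    evalComb∈Ideal []                []          = []∈Ideal H
    evalComb∈Ideal ((a , e , h) ∷ K) (Gh ∷ K⊆G) =
      ++∈Ideal H (term* a e h) (evalComb K)
        (term*∈Ideal H a e h (G⊆⟨H⟩ h Gh)) (evalComb∈Ideal K K⊆G)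

module Cor10Proof {c ℓ} (F : Field c ℓ) (s : ℕ) (as : Vec ℕ s) (k a b : ℕ)
  {{_ : NonZero k}} {{_ : NonZero a}} {{_ : NonZero b}} (a⊥b : Coprime a b) where

  open import Level using (_⊔_)
  open import Data.Nat using (_+_; _*_; _∸_; _≤_; suc; zero; s≤s)
  open import Data.Nat.Properties
  open import Data.Nat.Tactic.RingSolver using (solve-∀)
  open import Data.Vec using ([]; _∷_; splitAt)
  open import Data.Product using (_,_)
  open import Data.Sum using (inj₁; inj₂)
  open import Function.Bundles using (_⇔_; mk⇔; Equivalence)
  open import Function.Construct.Identity using (⇔-id)
  open import Relation.Binary.PropositionalEquality
    using (_≡_; refl; sym; trans; cong; cong₂; subst₂)
  open Equivalence using (to; from)
  open Poly F
  open BinomialIdeals F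
  open Cor10 s as k a b
  open TwoGeneratorBoxes
  open Sumsets
  module F = Field F

  xy : ℕ → ℕ → Monomial (s + 2)
  xy = ext ε

  infix 4 _~_
  _~_ : Monomial (s + 2) → Monomial (s + 2) → Set (c ⊔ ℓ)
  A ~ B = binomial A B ∈Ideal JGen

  xy-·ₘ : ∀ i j i′ j′ → xy i j ·ₘ xy i′ j′ ≡ xy (i + i′) (j + j′)
  xy-·ₘ i j i′ j′ = trans (++-·ₘ ε ε (i ∷ j ∷ []) (i′ ∷ j′ ∷ []))
                          (cong (λ e → ext e (i + i′) (j + j′)) (·ₘ-identityˡ ε))

  ext≡ext₀·ₘxy : ∀ α i j → ext α i j ≡ ext α 0 0 ·ₘ xy i j
  ext≡ext₀·ₘxy α i j = sym (trans (++-·ₘ α ε (0 ∷ 0 ∷ []) (i ∷ j ∷ []))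
                                  (cong (λ e → ext e i j) (·ₘ-identityʳ α)))

  exchangeGenerator : Pol (s + 2)
  exchangeGenerator = mono (xy (b ∸ 1) (a ∸ 1)) *ₚ binomial (xy b 0) (xy 0 a)

  exchangeGenerator≈ :
    exchangeGenerator ≈ₚ binomial (xy (b ∸ 1 + b) (a ∸ 1)) (xy (b ∸ 1) (a ∸ 1 + a))
  exchangeGenerator≈ = subst₂ (λ A B → exchangeGenerator ≈ₚ binomial A B)
    (trans (xy-·ₘ (b ∸ 1) (a ∸ 1) b 0) (cong (xy (b ∸ 1 + b)) (+-identityʳ (a ∸ 1))))
    (trans (xy-·ₘ (b ∸ 1) (a ∸ 1) 0 a) (cong (λ i → xy i (a ∸ 1 + a)) (+-identityʳ (b ∸ 1))))
    (mono-*ₚ-binomial (xy (b ∸ 1) (a ∸ 1)) (xy b 0) (xy 0 a))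

  exchangeGenerator∈J : xy (b ∸ 1) (a ∸ 1 + a) ~ xy (b ∸ 1 + b) (a ∸ 1)
  exchangeGenerator∈J =
    binomial-sym∈Ideal JGen (xy (b ∸ 1 + b) (a ∸ 1)) (xy (b ∸ 1) (a ∸ 1 + a))
    (∈Ideal-resp JGen (binomial (xy (b ∸ 1 + b) (a ∸ 1)) (xy (b ∸ 1) (a ∸ 1 + a)))
      exchangeGenerator (λ e → F.sym (exchangeGenerator≈ e))
      (gen∈Ideal JGen exchangeGenerator (inj₂ λ _ → F.refl)))

  trade∈J : ∀ {i j} → b ≤ suc i → a ≤ suc j → xy i (j + a) ~ xy (i + b) j
  trade∈J b≤1+i a≤1+j
    with u , refl ← m≤n⇒∃[o]m+o≡n (∸-monoˡ-≤ 1 b≤1+i)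
    with v , refl ← m≤n⇒∃[o]m+o≡n (∸-monoˡ-≤ 1 a≤1+j)
    = subst₂ _~_
        (trans (xy-·ₘ u v (b ∸ 1) (a ∸ 1 + a))
               (cong₂ xy (+-comm u (b ∸ 1)) (+-exchange v (a ∸ 1) a)))
        (trans (xy-·ₘ u v (b ∸ 1 + b) (a ∸ 1))
               (cong₂ xy (+-exchange u (b ∸ 1) b) (+-comm v (a ∸ 1))))
        (binomial-·ₘ∈Ideal JGen (xy u v) (xy (b ∸ 1) (a ∸ 1 + a)) (xy (b ∸ 1 + b) (a ∸ 1))
          exchangeGenerator∈J)
    where
    +-exchange : ∀ x y z → x + (y + z) ≡ y + x + z
    +-exchange x y z = trans (sym (+-assoc x y z)) (cong (_+ z) (+-comm x y))

  exchange∈J : ∀ t {i j} → b ≤ suc i → a ≤ suc j → xy i (j + t * a) ~ xy (i + t * b) j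
  exchange∈J zero {i} {j} _ _ =
    subst₂ _~_ (cong (xy i) (sym (+-identityʳ j))) (cong (λ x → xy x j) (sym (+-identityʳ i)))
      (binomial-refl∈Ideal JGen (xy i j))
  exchange∈J (suc t) {i} {j} b≤1+i a≤1+j =
    subst₂ _~_ (cong (xy i) (trans (+-assoc j (t * a) a) (cong (j +_) (+-comm (t * a) a))))
               (cong (λ x → xy x j) (+-assoc i b (t * b)))
      (binomial-trans∈Ideal JGen
        (xy i (j + t * a + a)) (xy (i + b) (j + t * a)) (xy (i + b + t * b) j)
        (trade∈J b≤1+i (≤-trans a≤1+j (s≤s (m≤m+n j (t * a)))))
        (exchange∈J t (≤-trans b≤1+i (s≤s (m≤m+n i b))) a≤1+j))

  sameBox⇒~ : ∀ {i j i′ j′} → SameBox a b i j i′ j′ → xy i j ~ xy i′ j′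
  sameBox⇒~ {i} {j} {i′} E with sameBox-classify a⊥b E
  ... | inj₁ (refl , refl) = binomial-refl∈Ideal JGen (xy i j)
  ... | inj₂ (inj₁ (t , refl , refl , b≤1+i , a≤1+j′)) = exchange∈J t b≤1+i a≤1+j′
  ... | inj₂ (inj₂ (t , refl , refl , b≤1+i′ , a≤1+j)) =
    binomial-sym∈Ideal JGen (xy i′ (j + t * a)) (xy (i′ + t * b) j) (exchange∈J t b≤1+i′ a≤1+j)

  binomialGen⇒~ : ∀ α β → SumsetEq gensS α β → α ~ β
  binomialGen⇒~ α β E
    with α′ , i ∷ j ∷ [] , refl ← splitAt s α
    with β′ , i′ ∷ j′ ∷ [] , refl ← splitAt s β
    with w≡ , boxes ← to (sumsetEq-singletonsAndPairs as) E
    = subst₂ _~_ (sym (ext≡ext₀·ₘxy α′ i j)) (sym (ext≡ext₀·ₘxy β′ i′ j′))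
        (binomial-·ₘ-cong∈Ideal JGen (ext α′ 0 0) (ext β′ 0 0) (xy i j) (xy i′ j′)
          (gen∈Ideal JGen (binomial (ext α′ 0 0) (ext β′ 0 0))
            (inj₁ (α′ , β′ , from (sumsetEq-singletons as α′ β′) w≡ , λ _ → F.refl)))
          (sameBox⇒~ (sameBox-unscale k boxes)))

  jGen⇒binomialGen : ∀ h → JGen h → h ∈Ideal BinomialGen gensS
  jGen⇒binomialGen h (inj₁ (α , β , E , h≈)) =
    gen∈Ideal (BinomialGen gensS) h
      (ext α 0 0 , ext β 0 0
      , from (sumsetEq-singletonsAndPairs as) (to (sumsetEq-singletons as α β) E , λ _ → ⇔-id _)
      , h≈)
  jGen⇒binomialGen h (inj₂ h≈) =
    gen∈Ideal (BinomialGen gensS) h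
      (xy (b ∸ 1 + b) (a ∸ 1) , xy (b ∸ 1) (a ∸ 1 + a)
      , from (sumsetEq-singletonsAndPairs as)
          (refl , trade⇒sameBox (*-comm-middle b k a) (m≤n+m∸n b 1) (m≤n+m∸n a 1))
      , λ e → F.trans (h≈ e) (exchangeGenerator≈ e))
    where
    *-comm-middle : ∀ x y z → x * (y * z) ≡ z * (y * x)
    *-comm-middle = solve-∀

  I_S⇔J : ∀ f → I_S f ⇔ J f
  I_S⇔J f = mk⇔
    (∈Ideal-trans (λ h (α , β , E , h≈) →
      ∈Ideal-resp JGen h (binomial α β) h≈ (binomialGen⇒~ α β E)) f)
    (∈Ideal-trans jGen⇒binomialGen f)

corollary10 : ∀ {c ℓ : Level} (F : Field c ℓ) (𝐚 𝐛 k s : ℕ) (as : Vec ℕ s)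
    → 1 ≤ 𝐚 → 𝐚 < 𝐛 → Coprime 𝐚 𝐛 → 1 ≤ k → All (1 ≤_) as
    → let open Poly F in let open Cor10 s as k 𝐚 𝐛 in
      ∀ (f : Pol (s Data.Nat.+ 2)) → I_S f ⇔ J f
corollary10 F 𝐚 𝐛 k s as 1≤𝐚 𝐚<𝐛 𝐚⊥𝐛 1≤k _ = I_S⇔J
  where
  open Cor10Proof F s as k 𝐚 𝐛
    {{>-nonZero 1≤k}} {{>-nonZero 1≤𝐚}} {{>-nonZero (<-trans 1≤𝐚 𝐚<𝐛)}} 𝐚⊥𝐛
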